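{- Let $\mathcal{C}$ be the vector space with basis $\mathbf{P}^\pi$, $\pi$ ranging over nonempty nondecreasing parking functions, equipped with the duplicial operations $\mathbf{P}^\alpha\succ\mathbf{P}^\beta=\mathbf{P}^{\alpha\bullet\beta}$ and $\mathbf{P}^\alpha\prec\mathbf{P}^\beta=\mathbf{P}^{\alpha\circ\beta}$. Define the linear map $\delta:\mathcal{C}\to\mathcal{C}\otimes\mathcal{C}$ by $$\delta(\mathbf{P}^\pi)=\sum_{k=1}^{n-1}\mathbf{P}^{\mathrm{park}(\pi_1\cdots\pi_k)}\otimes\mathbf{P}^{\mathrm{park}(\pi_{k+1}\cdots\pi_n)}\qquad(\pi=\pi_1\cdots\pi_n).$$ Then $(\mathcal{C},\prec,\succ,\delta)$ is a duplicial bialgebra. That is, for all $x,y\in\mathcal{C}$ and $*\in\{\prec,\succ\}$, $$\delta(x*y)=x\otimes y+\sum_{(x)}x_{(1)}\otimes(x_{(2)}*y)+\sum_{(y)}(x*y_{(1)})\otimes y_{(2)},$$ where $\delta x=\sum_{(x)}x_{(1)}\otimes x_{(2)}$ in Sweedler notation.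
   Context: A nondecreasing parking function of length $n$ is a nondecreasing word $\pi_1\cdots\pi_n$ of positive integers with $\pi_i\le i$ for all $i$. For a word $\beta$, $\beta[k]$ denotes $\beta$ with $k$ added to each letter. For $\alpha$ of length $k$: $\alpha\bullet\beta=\alpha\cdot\beta[k]$ and $\alpha\circ\beta=\alpha\cdot\beta[\max(\alpha)-1]$, where $\cdot$ is concatenation. Parkization of a word $u=u_1\cdots u_n$ of positive integers is defined recursively. Let $d(u)=\min\{i:\#\{j:u_j\le i\}<i\}$. If $d(u)=n+1$, then $u$ is a parking function and $\mathrm{park}(u)=u$. Otherwise let $u'$ be obtained from $u$ by decrementing by $1$ every letter greater than $d(u)$, and set $\mathrm{park}(u)=\mathrm{park}(u')$. For a nondecreasing word, $\mathrm{park}$ returns a nondecreasing parking function. -}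

module Defs where

open import Level using (Level)
open import Data.Nat using (ℕ; zero; suc; _+_; _∸_; _⊔_; _≤_; _<_; _≤?_; _<?_)
open import Data.Nat.Properties using () renaming (_≟_ to _≟ℕ_)
open import Data.List using (List; []; _∷_; _++_; map; length; filter; foldr; take; drop; concatMap; lookup)
import Data.List.Properties as LP
open import Data.Nat.ListAction using (sum)
open import Data.List.Relation.Unary.All using (All)
open import Data.List.Relation.Unary.Linked using (Linked)
open import Data.Fin using (Fin; toℕ)
open import Data.Product using (_×_; _,_; proj₁; proj₂)
import Data.Product.Properties as PP
open import Relation.Nullary using (¬_; yes; no)
open import Relation.Binary.Definitions using (DecidableEquality)
open import Relation.Binary.PropositionalEquality using (_≡_)
open import Algebra.Bundles using (CommutativeRing)

Word : Set
Word = List ℕ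

-- nonempty nondecreasing parking function: nonempty, nondecreasing,
-- and 1 ≤ π_i ≤ i (positions 1-based; Fin index i is position i+1)
IsNDPF : Word → Set
IsNDPF w = (¬ (w ≡ [])) × Linked _≤_ w
         × ((i : Fin (length w)) → (1 ≤ lookup w i) × (lookup w i ≤ suc (toℕ i)))

shift : ℕ → Word → Word
shift k = map (k +_)

maxW : Word → ℕ
maxW = foldr _⊔_ 0

_•_ : Word → Word → Word
α • β = α ++ shift (length α) β

_∘w_ : Word → Word → Word
α ∘w β = α ++ shift (maxW α ∸ 1) β

countLe : ℕ → Word → ℕ
countLe i u = length (filter (_≤? i) u)

-- first i ∈ {start, start+1, ...} (at most `steps` tries) with countLe i u < i;
-- returns the last candidate if none found earlier
findD : ℕ → ℕ → Word → ℕ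
findD zero start u = start
findD (suc steps) start u with countLe start u <? start
... | yes _ = start
... | no  _ = findD steps (suc start) u

-- d(u) = min { i ≥ 1 : #{j : u_j ≤ i} < i }  (always ≤ n+1)
d : Word → ℕ
d u = findD (length u) 1 u

decAbove : ℕ → Word → Word
decAbove k = map (λ x → step x)
  where
  step : ℕ → ℕ
  step x with suc k ≤? x
  ... | yes _ = x ∸ 1
  ... | no  _ = x

-- fuel-bounded recursion; each nontrivial step strictly decreases the
-- letter sum, so fuel = sum u + 1 is always sufficient
parkFuel : ℕ → Word → Word
parkFuel zero u = u
parkFuel (suc f) u with d u ≟ℕ suc (length u)
... | yes _ = u
... | no  _ = parkFuel f (decAbove (d u) u)

park : Word → Word
park u = parkFuel (suc (sum u)) u

data Side : Set where
  prec succ : Side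

opW : Side → Word → Word → Word
opW prec = _∘w_
opW succ = _•_

module Lin {c ℓ : Level} (R : CommutativeRing c ℓ) where
  open CommutativeRing R using (Carrier; 0#; _≈_) renaming (_+_ to _+R_; _*_ to _*R_)

  -- formal sum Σ r_i · e_{a_i}
  LC : Set → Set c
  LC A = List (Carrier × A)

  coeff : {A : Set} → DecidableEquality A → LC A → A → Carrier
  coeff eq [] a = 0#
  coeff eq ((r , b) ∷ xs) a with eq b a
  ... | yes _ = r +R coeff eq xs a
  ... | no  _ = coeff eq xs a

  decW : DecidableEquality Word
  decW = LP.≡-dec _≟ℕ_

  decWW : DecidableEquality (Word × Word)
  decWW = PP.≡-dec decW decW

  -- elements of C ⊗ C (basis P^a ⊗ P^b indexed by pairs (a , b))
  T : Set c
  T = LC (Word × Word)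

  _≈T_ : T → T → Set ℓ
  s ≈T t = ∀ p → coeff decWW s p ≈ coeff decWW t p

  InC : LC Word → Set c
  InC x = All (λ t → IsNDPF (proj₂ t)) x

  mulC : Side → LC Word → LC Word → LC Word
  mulC s x y = concatMap (λ { (r , a) → map (λ { (q , b) → (r *R q , opW s a b) }) y }) x

  tensor : LC Word → LC Word → T
  tensor x y = concatMap (λ { (r , a) → map (λ { (q , b) → (r *R q , (a , b)) }) y }) x

  range1 : ℕ → List ℕ
  range1 n = go n
    where
    go : ℕ → List ℕ
    go zero = []
    go (suc m) = go m ++ (suc m ∷ [])

  δW : Word → List (Word × Word)
  δW π = map (λ k → (park (take k π) , park (drop k π))) (range1 (length π ∸ 1))

  δ : LC Word → T
  δ x = concatMap (λ { (r , π) → map (λ ab → (r , ab)) (δW π) }) x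

  leftTerm : Side → LC Word → LC Word → T
  leftTerm s x y =
    concatMap (λ { (r , (a , b)) → map (λ { (q , c) → (r *R q , (a , opW s b c)) }) y }) (δ x)

  rightTerm : Side → LC Word → LC Word → T
  rightTerm s x y =
    concatMap (λ { (r , (a , b)) → map (λ { (q , c) → (q *R r , (opW s c a , b)) }) x }) (δ y)

module Submission where

-- Both sides of the compatibility law are bilinear in x and y, so we compare
-- coefficients at a fixed basis tensor: each side becomes a double sum over
-- the terms of x and y, and the law reduces to its basis case (δW-op)
--   δW(α * β) = [cuts inside α, times β] ++ (α , β) ∷ [α times cuts inside β].
-- Writing α * β = α · β[σ] (σ = |α| for ≻, max α − 1 for ≺), the cut of α * β
-- inside α has the suffix (suffix of α) · β[σ], the middle cut gives α and
-- β[σ], and a cut inside β has the prefix α · (prefix of β)[σ].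
-- To parkize these words we replace the iterative definition of park on
-- nondecreasing words by a one-pass algorithm `scan`: each output letter keeps
-- the gap to the previous input letter but is capped by its position.

open import Defs
open import Algebra.Bundles using (CommutativeRing)
open import Data.List using (_++_)

module ParkingWords where
  open import Data.Empty using (⊥-elim)
  open import Data.Fin using (Fin; toℕ) renaming (zero to fzero; suc to fsuc)
  open import Data.List using ([]; _∷_; map; length; take; drop; filter; lookup)
  open import Data.List.Properties
    using (length-++; length-drop; ++-identityʳ; ++-assoc; map-id; filter-++; filter-all; filter-none; filter-accept)
  open import Data.List.Relation.Unary.All using (All; []; _∷_)
  open import Data.List.Relation.Unary.Linked using (Linked; _∷_)
  open import Data.Nat using (ℕ; zero; suc; _+_; _∸_; _⊔_; _⊓_; _≤_; _<_; z≤n; s≤s; _<?_)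
  open import Data.Nat.Properties
  open import Data.Nat.ListAction using (sum)
  open import Data.Nat.ListAction.Properties using (sum-++)
  open import Data.Nat.Solver using (module +-*-Solver)
  open import Data.Product using (_×_; _,_; proj₁; proj₂)
  open import Data.Unit using (⊤; tt)
  open import Relation.Nullary using (¬_; yes; no)
  open import Relation.Binary.PropositionalEquality

  Nondec : ℕ → Word → Set
  Nondec v []      = ⊤
  Nondec v (x ∷ w) = v ≤ x × Nondec x w

  -- `Capped j w`: the k-th letter of w (counting from 0) is ≤ j + k.  A
  -- nondecreasing word u is a parking function iff Nondec 1 u and Capped 1 u.
  Capped : ℕ → Word → Set
  Capped j []      = ⊤
  Capped j (x ∷ w) = x ≤ j × Capped (suc j) w

  lastOr : ℕ → Word → ℕ
  lastOr v []      = v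
  lastOr v (x ∷ w) = lastOr x w

  Nondec-weaken : ∀ {v v′} w → v′ ≤ v → Nondec v w → Nondec v′ w
  Nondec-weaken []      _    _          = tt
  Nondec-weaken (x ∷ w) v′≤v (v≤x , nd) = ≤-trans v′≤v v≤x , nd

  Nondec-++ : ∀ {v} l r → Nondec v l → Nondec (lastOr v l) r → Nondec v (l ++ r)
  Nondec-++ []      r _          nr = nr
  Nondec-++ (x ∷ l) r (v≤x , nl) nr = v≤x , Nondec-++ l r nl nr

  Nondec-++ˡ : ∀ {v} l r → Nondec v (l ++ r) → Nondec v l
  Nondec-++ˡ []      r _          = tt
  Nondec-++ˡ (x ∷ l) r (v≤x , nd) = v≤x , Nondec-++ˡ l r nd

  Nondec-++ʳ : ∀ {v} l r → Nondec v (l ++ r) → Nondec (lastOr v l) r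
  Nondec-++ʳ []      r nd       = nd
  Nondec-++ʳ (x ∷ l) r (_ , nd) = Nondec-++ʳ l r nd

  Nondec-pred : ∀ {v} w → Nondec v w → Nondec (v ∸ 1) (map (_∸ 1) w)
  Nondec-pred []      _          = tt
  Nondec-pred (x ∷ w) (v≤x , nd) = ∸-monoˡ-≤ 1 v≤x , Nondec-pred w nd

  Capped-++ : ∀ {j} l r → Capped j l → Capped (j + length l) r → Capped j (l ++ r)
  Capped-++ {j} []      r _          cr = subst (λ i → Capped i r) (+-identityʳ j) cr
  Capped-++ {j} (x ∷ l) r (x≤j , cl) cr =
    x≤j , Capped-++ l r cl (subst (λ i → Capped i r) (+-suc j (length l)) cr)

  lastOr-< : ∀ {j v} l → Capped j l → v < j → lastOr v l < j + length l
  lastOr-< {j} []      _          v<j = subst (_ <_) (sym (+-identityʳ j)) v<j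
  lastOr-< {j} (x ∷ l) (x≤j , cl) _   =
    subst (lastOr x l <_) (sym (+-suc j (length l))) (lastOr-< l cl (s≤s x≤j))

  Capped⇒All≤ : ∀ {j k} l → Capped j l → j + length l ≤ k → All (_≤ k) l
  Capped⇒All≤     []      _          _  = []
  Capped⇒All≤ {j} (x ∷ l) (x≤j , cl) le =
    ≤-trans x≤j (≤-trans (m≤m+n j _) le)
    ∷ Capped⇒All≤ l cl (≤-trans (≤-reflexive (sym (+-suc j (length l)))) le)

  -- The next output letter: it keeps the gap x ∸ u to the previous input
  -- letter u above the previous output letter p, but is capped by the
  -- position i.
  next : ℕ → ℕ → ℕ → ℕ → ℕ
  next i p u x = i ⊓ (p + (x ∸ u))

  -- `scan i p u w`: the output of the pass over w, started at position i
  -- after an output letter p produced from an input letter u.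
  scan : ℕ → ℕ → ℕ → Word → Word
  scan i p u []      = []
  scan i p u (x ∷ w) = next i p u x ∷ scan (suc i) (next i p u x) x w

  lastOut : ℕ → ℕ → ℕ → Word → ℕ
  lastOut i p u []      = p
  lastOut i p u (x ∷ w) = lastOut (suc i) (next i p u x) x w

  parkScan : Word → Word
  parkScan = scan 1 0 0

  length-scan : ∀ i p u w → length (scan i p u w) ≡ length w
  length-scan i p u []      = refl
  length-scan i p u (x ∷ w) = cong suc (length-scan _ _ _ w)

  scan-++ : ∀ i p u t z →
    scan i p u (t ++ z) ≡ scan i p u t ++ scan (i + length t) (lastOut i p u t) (lastOr u t) z
  scan-++ i p u []      z = cong (λ j → scan j p u z) (sym (+-identityʳ i))
  scan-++ i p u (x ∷ t) z = cong (next i p u x ∷_) (trans (scan-++ (suc i) y x t z)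
    (cong (λ j → scan (suc i) y x t ++ scan j (lastOut (suc i) y x t) (lastOr x t) z)
          (sym (+-suc i (length t)))))
    where y = next i p u x

  scan-gap : ∀ i p c u w → scan i p (c + u) (map (c +_) w) ≡ scan i p u w
  scan-gap i p c u []      = refl
  scan-gap i p c u (x ∷ w) =
    cong₂ _∷_ same (trans (cong (λ y → scan (suc i) y (c + x) (map (c +_) w)) same)
                          (scan-gap (suc i) (next i p u x) c x w))
    where
    same : next i p (c + u) (c + x) ≡ next i p u x
    same = cong (λ g → i ⊓ (p + g)) ([m+n]∸[m+o]≡n∸o c x u)

  scan-lifted : ∀ {i j} off v z → Nondec v z → Capped j z → off + j ≤ i →
    scan i (off + v) v z ≡ map (off +_) z
  scan-lifted         off v []      _          _          _  = refl
  scan-lifted {i} {j} off v (x ∷ z) (v≤x , nd) (x≤j , cp) le =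
    cong₂ _∷_ lifted (trans (cong (λ y → scan (suc i) y x z) lifted)
      (scan-lifted off x z nd cp (subst (_≤ suc i) (sym (+-suc off j)) (s≤s le))))
    where
    lifted : next i (off + v) v x ≡ off + x
    lifted = trans (cong (i ⊓_) (trans (+-assoc off v (x ∸ v)) (cong (off +_) (m+[n∸m]≡n v≤x))))
                   (m≥n⇒m⊓n≡n (≤-trans (+-monoʳ-≤ off x≤j) le))

  scan-fixes : ∀ {i v} z → Nondec v z → Capped i z → scan i v v z ≡ z
  scan-fixes z nd cp = trans (scan-lifted 0 _ z nd cp ≤-refl) (map-id z)

  scan-fixed-++ : ∀ {i v} pre z → Nondec v pre → Capped i pre →
    scan i v v (pre ++ z) ≡ pre ++ scan (i + length pre) (lastOr v pre) (lastOr v pre) z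
  scan-fixed-++ {i} {v} [] z _ _ = cong (λ j → scan j v v z) (sym (+-identityʳ i))
  scan-fixed-++ {i} {v} (x ∷ pre) z (v≤x , nd) (x≤i , cp) = begin
    next i v v x ∷ scan (suc i) (next i v v x) x (pre ++ z)
      ≡⟨ cong (λ y → y ∷ scan (suc i) y x (pre ++ z)) kept ⟩
    x ∷ scan (suc i) x x (pre ++ z)
      ≡⟨ cong (x ∷_) (scan-fixed-++ pre z nd cp) ⟩
    x ∷ pre ++ scan (suc i + length pre) w w z
      ≡⟨ cong (λ j → x ∷ pre ++ scan j w w z) (sym (+-suc i (length pre))) ⟩
    x ∷ pre ++ scan (i + suc (length pre)) w w z ∎
    where
    open ≡-Reasoning
    w = lastOr x pre
    kept : next i v v x ≡ x
    kept = trans (cong (i ⊓_) (m+[n∸m]≡n v≤x)) (m≥n⇒m⊓n≡n x≤i)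

  scan-lower : ∀ i p x rest → Nondec (suc x) rest →
    scan i p x (map (_∸ 1) rest) ≡ scan i p (suc x) rest
  scan-lower i p x rest nd =
    sym (trans (cong (scan i p (1 + x)) (sym (raise-lower rest (s≤s z≤n) nd)))
               (scan-gap i p 1 x (map (_∸ 1) rest)))
    where
    raise-lower : ∀ {v} l → 1 ≤ v → Nondec v l → map suc (map (_∸ 1) l) ≡ l
    raise-lower []            _   _          = refl
    raise-lower (suc y ∷ l) _   (_ , nd′)    = cong (suc y ∷_) (raise-lower l (s≤s z≤n) nd′)
    raise-lower (zero ∷ l)  1≤v (v≤0 , _)    = ⊥-elim (<⇒≱ 1≤v v≤0)

  next≤ : ∀ i p u x → next i p u x ≤ i
  next≤ i p u x = m⊓n≤m i _

  next≥ : ∀ {i p} u x → p ≤ i → p ≤ next i p u x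
  next≥ u x p≤i = ⊓-glb p≤i (m≤m+n _ _)

  lastOut-< : ∀ i p u t → p < i → lastOut i p u t < i + length t
  lastOut-< i p u []      p<i = subst (p <_) (sym (+-identityʳ i)) p<i
  lastOut-< i p u (x ∷ t) p<i = subst (lastOut (suc i) (next i p u x) x t <_) (sym (+-suc i (length t)))
    (lastOut-< (suc i) _ x t (s≤s (next≤ i p u x)))

  lastOut-≥ : ∀ i p u t → p < i → p ≤ lastOut i p u t
  lastOut-≥ i p u []      p<i = ≤-refl
  lastOut-≥ i p u (x ∷ t) p<i =
    ≤-trans (next≥ u x (<⇒≤ p<i)) (lastOut-≥ (suc i) _ x t (s≤s (next≤ i p u x)))

  maxW-scan : ∀ i p u t → p < i → p ⊔ maxW (scan i p u t) ≡ lastOut i p u t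
  maxW-scan i p u []      p<i = ⊔-identityʳ p
  maxW-scan i p u (x ∷ t) p<i =
    trans (sym (⊔-assoc p y _))
      (trans (cong (_⊔ maxW (scan (suc i) y x t)) (m≤n⇒m⊔n≡n (next≥ u x (<⇒≤ p<i))))
             (maxW-scan (suc i) y x t (s≤s (next≤ i p u x))))
    where y = next i p u x

  lastOr≤lastOut+ : ∀ i p u k t → u ≤ p + k → Capped (i + k) t → lastOr u t ≤ lastOut i p u t + k
  lastOr≤lastOut+ i p u k []      u≤ _          = u≤
  lastOr≤lastOut+ i p u k (x ∷ t) u≤ (x≤ , cp) = lastOr≤lastOut+ (suc i) _ x k t x≤y+k cp
    where
    open ≤-Reasoning
    x≤y+k : x ≤ next i p u x + k
    x≤y+k = subst (x ≤_) (sym (+-distribʳ-⊓ k i (p + (x ∸ u)))) (⊓-glb x≤ (begin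
      x                 ≤⟨ m≤n+m∸n x u ⟩
      u + (x ∸ u)       ≤⟨ +-monoˡ-≤ (x ∸ u) u≤ ⟩
      p + k + (x ∸ u)   ≡⟨ +-assoc p k (x ∸ u) ⟩
      p + (k + (x ∸ u)) ≡⟨ cong (p +_) (+-comm k (x ∸ u)) ⟩
      p + ((x ∸ u) + k) ≡⟨ sym (+-assoc p (x ∸ u) k) ⟩
      p + (x ∸ u) + k   ∎))

  -- Locating d(u): on a nondecreasing word the search stops at the first
  -- letter that overflows its position.

  countLe-++ : ∀ i l r → countLe i (l ++ r) ≡ countLe i l + countLe i r
  countLe-++ i l r = trans (cong length (filter-++ (_≤? i) l r)) (length-++ (filter (_≤? i) l))

  count-reaches : ∀ {s} pre x rest → All (_≤ s) pre → x ≤ s →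
    suc (length pre) ≤ countLe s (pre ++ x ∷ rest)
  count-reaches {s} pre x rest pre≤s x≤s = begin
    suc (length pre)                         ≡⟨ +-comm 1 (length pre) ⟩
    length pre + 1                           ≤⟨ +-monoʳ-≤ (length pre) (s≤s z≤n) ⟩
    length pre + suc (countLe s rest)        ≡⟨ cong₂ _+_ (sym (cong length (filter-all (_≤? s) pre≤s)))
                                                           (sym (cong length (filter-accept (_≤? s) x≤s))) ⟩
    countLe s pre + countLe s (x ∷ rest)     ≡⟨ sym (countLe-++ s pre (x ∷ rest)) ⟩
    countLe s (pre ++ x ∷ rest)              ∎
    where open ≤-Reasoning

  count-stalls : ∀ {s} pre x rest → All (_≤ s) pre → Nondec x rest → s < x →
    countLe s (pre ++ x ∷ rest) ≡ length pre
  count-stalls {s} pre x rest pre≤s nd s<x = begin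
    countLe s (pre ++ x ∷ rest)           ≡⟨ countLe-++ s pre (x ∷ rest) ⟩
    countLe s pre + countLe s (x ∷ rest)  ≡⟨ cong₂ _+_ (cong length (filter-all (_≤? s) pre≤s))
                                                        (cong length (filter-none (_≤? s) (above x rest nd s<x))) ⟩
    length pre + 0                        ≡⟨ +-identityʳ _ ⟩
    length pre                            ∎
    where
    open ≡-Reasoning
    above : ∀ y l → Nondec y l → s < y → All (λ z → ¬ z ≤ s) (y ∷ l)
    above y []      _          s<y = <⇒≱ s<y ∷ []
    above y (z ∷ l) (y≤z , nd′) s<y = <⇒≱ s<y ∷ above z l nd′ (<-≤-trans s<y y≤z)

  data DView (u : Word) (v : ℕ) : Set where
    parking  : Capped 1 u → v ≡ suc (length u) → DView u v
    overflow : (pre : Word) (x : ℕ) (rest : Word) → u ≡ pre ++ x ∷ rest → Capped 1 pre →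
               suc (length pre) < x → v ≡ suc (length pre) → DView u v

  -- invariant of findD: the letters tried so far form a parking prefix
  findD-view : ∀ steps s u pre post → u ≡ pre ++ post → s ≡ suc (length pre) →
    length post ≡ steps → Capped 1 pre → Nondec 0 u → DView u (findD steps s u)
  findD-view zero _ _ pre [] refl refl _ cp _ =
    parking (subst (Capped 1) (sym (++-identityʳ pre)) cp)
            (cong suc (cong length (sym (++-identityʳ pre))))
  findD-view (suc steps) _ _ pre (x ∷ rest) refl refl len cp nd
    with countLe (suc (length pre)) (pre ++ x ∷ rest) <? suc (length pre)
  ... | yes few = overflow pre x rest refl cp overflows refl
    where
    overflows : suc (length pre) < x
    overflows = ≰⇒> (λ x≤ → <⇒≱ few (count-reaches pre x rest (Capped⇒All≤ pre cp ≤-refl) x≤))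
  ... | no enough = findD-view steps _ _ (pre ++ x ∷ []) rest
          (sym (++-assoc pre (x ∷ []) rest))
          (cong suc (trans (+-comm 1 (length pre)) (sym (length-++ pre))))
          (suc-injective len)
          (Capped-++ pre (x ∷ []) cp (fits , tt))
          nd
    where
    fits : x ≤ 1 + length pre
    fits = ≮⇒≥ (λ overflows → enough (subst (_< suc (length pre))
             (sym (count-stalls pre x rest (Capped⇒All≤ pre cp ≤-refl)
                    (proj₂ (Nondec-++ʳ pre (x ∷ rest) nd)) overflows))
             (n<1+n (length pre))))

  d-view : ∀ u → Nondec 0 u → DView u (d u)
  d-view u nd = findD-view (length u) 1 u [] u refl refl refl tt nd

  -- One step of the parkization loop lowers the overflowing suffix by one;
  -- this does not change the one-pass output, so the loop computes it.

  decAbove-≤ : ∀ k x l → x ≤ k → decAbove k (x ∷ l) ≡ x ∷ decAbove k l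
  decAbove-≤ k x l x≤k with suc k ≤? x
  ... | yes k<x = ⊥-elim (<⇒≱ k<x x≤k)
  ... | no  _   = refl

  decAbove-> : ∀ k x l → k < x → decAbove k (x ∷ l) ≡ (x ∸ 1) ∷ decAbove k l
  decAbove-> k x l k<x with suc k ≤? x
  ... | yes _   = refl
  ... | no  k≮x = ⊥-elim (k≮x k<x)

  decAbove-overflow : ∀ k pre x rest → All (_≤ k) pre → Nondec x rest → k < x →
    decAbove k (pre ++ x ∷ rest) ≡ pre ++ map (_∸ 1) (x ∷ rest)
  decAbove-overflow k (y ∷ pre) x rest (y≤k ∷ pre≤k) nd k<x =
    trans (decAbove-≤ k y _ y≤k) (cong (y ∷_) (decAbove-overflow k pre x rest pre≤k nd k<x))
  decAbove-overflow k [] x [] [] _ k<x = decAbove-> k x [] k<x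
  decAbove-overflow k [] x (y ∷ rest) [] (x≤y , nd) k<x =
    trans (decAbove-> k x (y ∷ rest) k<x) (cong ((x ∸ 1) ∷_) (decAbove-overflow k [] y rest [] nd (<-≤-trans k<x x≤y)))

  -- at the overflowing letter the output hits its cap, so lowering that
  -- letter and everything after it leaves the one-pass output unchanged
  parkScan-lower : ∀ pre x rest → Capped 1 pre → Nondec 0 (pre ++ suc x ∷ rest) →
    suc (length pre) < suc x →
    parkScan (pre ++ map (_∸ 1) (suc x ∷ rest)) ≡ parkScan (pre ++ suc x ∷ rest)
  parkScan-lower pre x rest cp nd D<x = begin
    parkScan (pre ++ x ∷ map (_∸ 1) rest)
      ≡⟨ scan-fixed-++ pre _ npre cp ⟩
    pre ++ next D w w x ∷ scan (suc D) (next D w w x) x (map (_∸ 1) rest)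
      ≡⟨ cong (λ y → pre ++ y ∷ scan (suc D) y x (map (_∸ 1) rest)) (capped x (≤-pred D<x)) ⟩
    pre ++ D ∷ scan (suc D) D x (map (_∸ 1) rest)
      ≡⟨ cong (λ t → pre ++ D ∷ t) (scan-lower (suc D) D x rest nrest) ⟩
    pre ++ D ∷ scan (suc D) D (suc x) rest
      ≡⟨ cong (λ y → pre ++ y ∷ scan (suc D) y (suc x) rest) (sym (capped (suc x) (<⇒≤ D<x))) ⟩
    pre ++ scan D w w (suc x ∷ rest)
      ≡⟨ sym (scan-fixed-++ pre _ npre cp) ⟩
    parkScan (pre ++ suc x ∷ rest) ∎
    where
    open ≡-Reasoning
    D = suc (length pre)
    w = lastOr 0 pre
    npre : Nondec 0 pre
    npre = Nondec-++ˡ pre _ nd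
    nrest : Nondec (suc x) rest
    nrest = proj₂ (Nondec-++ʳ pre (suc x ∷ rest) nd)
    capped : ∀ y → D ≤ y → next D w w y ≡ D
    capped y D≤y = trans (cong (D ⊓_) (m+[n∸m]≡n (≤-trans (<⇒≤ (lastOr-< pre cp (s≤s z≤n))) D≤y)))
                         (m≤n⇒m⊓n≡m D≤y)

  sum-pred≤ : ∀ l → sum (map (_∸ 1) l) ≤ sum l
  sum-pred≤ []      = z≤n
  sum-pred≤ (x ∷ l) = +-mono-≤ (m∸n≤m x 1) (sum-pred≤ l)

  parkFuel-scan : ∀ f u → Nondec 0 u → sum u < f → parkFuel f u ≡ parkScan u
  parkFuel-scan zero u _ ()
  parkFuel-scan (suc f) u nd fuel with d u ≟ suc (length u) | d-view u nd
  ... | yes _  | parking cp _ = sym (scan-fixes u nd cp)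
  ... | no d≢  | parking _ d≡ = ⊥-elim (d≢ d≡)
  ... | yes d≡ | overflow pre x rest refl _ _ d≡′ =
    ⊥-elim (<⇒≢ (subst (length pre <_) (sym (length-++ pre)) (m<m+n (length pre) (s≤s z≤n)))
                 (suc-injective (trans (sym d≡′) d≡)))
  ... | no _   | overflow pre zero rest _ _ () _
  ... | no _   | overflow pre (suc x) rest refl cp D<x d≡ = begin
    parkFuel f (decAbove (d u) u)  ≡⟨ cong (λ k → parkFuel f (decAbove k u)) d≡ ⟩
    parkFuel f (decAbove D u)      ≡⟨ cong (parkFuel f) (decAbove-overflow D pre (suc x) rest
                                        (Capped⇒All≤ pre cp ≤-refl) nrest D<x) ⟩
    parkFuel f u′                  ≡⟨ parkFuel-scan f u′ nd′ fuel′ ⟩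
    parkScan u′                    ≡⟨ parkScan-lower pre x rest cp nd D<x ⟩
    parkScan u                     ∎
    where
    open ≡-Reasoning
    D = suc (length pre)
    u′ = pre ++ map (_∸ 1) (suc x ∷ rest)
    nrest : Nondec (suc x) rest
    nrest = proj₂ (Nondec-++ʳ pre (suc x ∷ rest) nd)
    nd′ : Nondec 0 u′
    nd′ = Nondec-++ pre _ (Nondec-++ˡ pre _ nd)
            (≤-trans (<⇒≤ (lastOr-< pre cp (s≤s z≤n))) (≤-pred D<x) , Nondec-pred rest nrest)
    fuel′ : sum u′ < f
    fuel′ = <-≤-trans (subst₂ _<_ (sym (sum-++ pre _)) (sym (sum-++ pre (suc x ∷ rest)))
                        (+-monoʳ-< (sum pre) (s≤s (+-monoʳ-≤ x (sum-pred≤ rest)))))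
                      (≤-pred fuel)

  park-scan : ∀ u → Nondec 0 u → park u ≡ parkScan u
  park-scan u nd = parkFuel-scan (suc (sum u)) u nd ≤-refl

  park-fixes : ∀ u → Nondec 0 u → Capped 1 u → park u ≡ u
  park-fixes u nd cp = trans (park-scan u nd) (scan-fixes u nd cp)

  Nondec-take : ∀ k {v} l → Nondec v l → Nondec v (take k l)
  Nondec-take zero    l       _          = tt
  Nondec-take (suc k) []      _          = tt
  Nondec-take (suc k) (x ∷ l) (v≤x , nd) = v≤x , Nondec-take k l nd

  Nondec-drop : ∀ k {v} l → Nondec v l → Nondec v (drop k l)
  Nondec-drop zero    l       nd         = nd
  Nondec-drop (suc k) []      _          = tt
  Nondec-drop (suc k) (x ∷ l) (v≤x , nd) = Nondec-drop k l (Nondec-weaken l v≤x nd)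

  Capped-take : ∀ k {j} l → Capped j l → Capped j (take k l)
  Capped-take zero    l       _          = tt
  Capped-take (suc k) []      _          = tt
  Capped-take (suc k) (x ∷ l) (x≤j , cp) = x≤j , Capped-take k l cp

  Capped-drop : ∀ k {j} l → Capped j l → Capped (j + k) (drop k l)
  Capped-drop zero    {j} l       cp       = subst (λ i → Capped i l) (sym (+-identityʳ j)) cp
  Capped-drop (suc k) []      _            = tt
  Capped-drop (suc k) {j} (x ∷ l) (_ , cp) =
    subst (λ i → Capped i (drop k l)) (sym (+-suc j k)) (Capped-drop k l cp)

  Nondec-shift : ∀ c {v} l → Nondec v l → Nondec (c + v) (map (c +_) l)
  Nondec-shift c []      _          = tt
  Nondec-shift c (x ∷ l) (v≤x , nd) = +-monoʳ-≤ c v≤x , Nondec-shift c l nd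

  Capped-shift : ∀ c {i j} l → Capped j l → c + j ≤ i → Capped i (map (c +_) l)
  Capped-shift c         []      _          _  = tt
  Capped-shift c {i} {j} (x ∷ l) (x≤j , cp) le =
    ≤-trans (+-monoʳ-≤ c x≤j) le , Capped-shift c l cp (subst (_≤ suc i) (sym (+-suc c j)) (s≤s le))

  maxW-lastOr : ∀ {v} l → Nondec v l → v ⊔ maxW l ≡ lastOr v l
  maxW-lastOr {v} []      _          = ⊔-identityʳ v
  maxW-lastOr {v} (x ∷ l) (v≤x , nd) =
    trans (sym (⊔-assoc v x (maxW l))) (trans (cong (_⊔ maxW l) (m≤n⇒m⊔n≡n v≤x)) (maxW-lastOr l nd))

  lastOr-drop : ∀ {v} k l → k < length l → lastOr v (drop k l) ≡ lastOr v l
  lastOr-drop zero    l       _         = refl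
  lastOr-drop (suc k) (x ∷ l) (s≤s k<l) = trans (lastOr-drop k l k<l) (default-irrelevant l (m<n⇒0<n k<l))
    where
    default-irrelevant : ∀ {v v′} l → 0 < length l → lastOr v l ≡ lastOr v′ l
    default-irrelevant (y ∷ l) _ = refl

  take-++-≤ : ∀ k (l r : Word) → k ≤ length l → take k (l ++ r) ≡ take k l
  take-++-≤ zero    l       r _         = refl
  take-++-≤ (suc k) (x ∷ l) r (s≤s k≤l) = cong (x ∷_) (take-++-≤ k l r k≤l)

  drop-++-≤ : ∀ k (l r : Word) → k ≤ length l → drop k (l ++ r) ≡ drop k l ++ r
  drop-++-≤ zero    l       r _         = refl
  drop-++-≤ (suc k) (x ∷ l) r (s≤s k≤l) = drop-++-≤ k l r k≤l

  take-++-length : ∀ j (l r : Word) → take (length l + j) (l ++ r) ≡ l ++ take j r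
  take-++-length j []      r = refl
  take-++-length j (x ∷ l) r = cong (x ∷_) (take-++-length j l r)

  drop-++-length : ∀ j (l r : Word) → drop (length l + j) (l ++ r) ≡ drop j r
  drop-++-length j []      r = refl
  drop-++-length j (x ∷ l) r = drop-++-length j l r

  data NDPF : Word → Set where
    ndpf : ∀ w′ → Nondec 1 w′ → Capped 2 w′ → NDPF (1 ∷ w′)

  linked⇒Nondec : ∀ y l → Linked _≤_ (y ∷ l) → Nondec y l
  linked⇒Nondec y []      _          = tt
  linked⇒Nondec y (z ∷ l) (y≤z ∷ lk) = y≤z , linked⇒Nondec z l lk

  bounds⇒Capped : ∀ j l → ((i : Fin (length l)) → lookup l i ≤ j + toℕ i) → Capped j l
  bounds⇒Capped j []      _     = tt
  bounds⇒Capped j (y ∷ l) bound = subst (y ≤_) (+-identityʳ j) (bound fzero) ,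
    bounds⇒Capped (suc j) l (λ i → subst (lookup l i ≤_) (+-suc j (toℕ i)) (bound (fsuc i)))

  toNDPF : ∀ w → IsNDPF w → NDPF w
  toNDPF []      (nonempty , _)        = ⊥-elim (nonempty refl)
  toNDPF (x ∷ w) (_ , linked , bounds) with ≤-antisym (proj₂ (bounds fzero)) (proj₁ (bounds fzero))
  ... | refl = ndpf w (linked⇒Nondec 1 w linked) (bounds⇒Capped 2 w (λ i → proj₂ (bounds (fsuc i))))

  shiftOf : Side → Word → ℕ
  shiftOf prec a = maxW a ∸ 1
  shiftOf succ a = length a

  opW-shift : ∀ s a b → opW s a b ≡ a ++ map (shiftOf s a +_) b
  opW-shift prec a b = refl
  opW-shift succ a b = refl

  parkScan-shift : ∀ c l → Nondec 1 l → parkScan (map (c +_) l) ≡ parkScan l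
  parkScan-shift c []      _          = refl
  parkScan-shift c (y ∷ l) (1≤y , nd) = cong₂ _∷_ (trans first (sym first′))
    (trans (cong (λ h → scan 2 h (c + y) (map (c +_) l)) first)
    (trans (scan-gap 2 1 c y l) (cong (λ h → scan 2 h y l) (sym first′))))
    where
    first : next 1 0 0 (c + y) ≡ 1
    first = m≤n⇒m⊓n≡m (≤-trans 1≤y (m≤n+m y c))
    first′ : next 1 0 0 y ≡ 1
    first′ = m≤n⇒m⊓n≡m 1≤y

  scan-block : ∀ {i p u} c off b′ → next i p u (c + 1) ≡ off + 1 → Nondec 1 b′ → Capped 2 b′ →
    off + 2 ≤ suc i → scan i p u (map (c +_) (1 ∷ b′)) ≡ map (off +_) (1 ∷ b′)
  scan-block {i} {p} {u} c off b′ first nd cp room = cong₂ _∷_ first (begin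
    scan (suc i) (next i p u (c + 1)) (c + 1) (map (c +_) b′) ≡⟨ cong (λ y → scan (suc i) y (c + 1) _) first ⟩
    scan (suc i) (off + 1) (c + 1) (map (c +_) b′)            ≡⟨ scan-gap (suc i) (off + 1) c 1 b′ ⟩
    scan (suc i) (off + 1) 1 b′                               ≡⟨ scan-lifted off 1 b′ nd cp room ⟩
    map (off +_) b′                                           ∎)
    where open ≡-Reasoning

  -- the arithmetic behind ≻: a block shifted by k + m reaches the cap 1 + m
  -- when the previous output p ≤ m trails the previous input u by at most k
  reaches-cap : ∀ m k p u → p ≤ m → u ≤ p + k → 1 + m ≤ p + (k + m + 1 ∸ u)
  reaches-cap m k p u p≤m u≤p+k = +-cancelʳ-≤ u (1 + m) _ (begin
    1 + m + u                 ≤⟨ +-monoʳ-≤ (1 + m) u≤p+k ⟩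
    1 + m + (p + k)           ≡⟨ solve 3 (λ m k p → (con 1 :+ m) :+ (p :+ k) := p :+ ((k :+ m) :+ con 1)) refl m k p ⟩
    p + (k + m + 1)           ≡⟨ cong (p +_) (sym (m∸n+n≡m u≤n)) ⟩
    p + ((k + m + 1 ∸ u) + u) ≡⟨ sym (+-assoc p _ u) ⟩
    p + (k + m + 1 ∸ u) + u   ∎)
    where
    open ≤-Reasoning
    open +-*-Solver
    u≤n : u ≤ k + m + 1
    u≤n = ≤-trans u≤p+k (≤-trans (≤-reflexive (+-comm p k)) (≤-trans (+-monoʳ-≤ k p≤m) (m≤m+n _ 1)))

  -- ≻: the block 1 · b′, shifted by the length k + |t| of the ambient word,
  -- reaches the cap 1 + |t| after any suffix t of a parking function.
  parkScan-• : ∀ k t b′ → Nondec 1 t → Capped (1 + k) t → Nondec 1 b′ → Capped 2 b′ →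
    parkScan (t ++ map ((k + length t) +_) (1 ∷ b′)) ≡ parkScan t • (1 ∷ b′)
  parkScan-• k t b′ nt ct nb cb = begin
    parkScan (t ++ map (n +_) (1 ∷ b′))                   ≡⟨ scan-++ 1 0 0 t _ ⟩
    parkScan t ++ scan (1 + m) p u (map (n +_) (1 ∷ b′)) ≡⟨ cong (parkScan t ++_) (scan-block {p = p} {u} n m b′ first nb cb room) ⟩
    parkScan t ++ map (m +_) (1 ∷ b′)                     ≡⟨ cong (λ L → parkScan t ++ map (L +_) (1 ∷ b′)) (sym (length-scan 1 0 0 t)) ⟩
    parkScan t • (1 ∷ b′)                                 ∎
    where
    open ≡-Reasoning
    m = length t
    n = k + m
    p = lastOut 1 0 0 t
    u = lastOr 0 t
    p≤m : p ≤ m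
    p≤m = ≤-pred (lastOut-< 1 0 0 t (s≤s z≤n))
    u≤p+k : u ≤ p + k
    u≤p+k = lastOr≤lastOut+ 1 0 0 k t z≤n ct
    first : next (1 + m) p u (n + 1) ≡ m + 1
    first = trans (m≤n⇒m⊓n≡m (reaches-cap m k p u p≤m u≤p+k)) (+-comm 1 m)
    room : m + 2 ≤ suc (1 + m)
    room = ≤-reflexive (+-comm m 2)

  -- ≺: the block 1 · b′, shifted by the last letter of t minus one, starts
  -- exactly at the last output letter.
  parkScan-∘ : ∀ t b′ → 0 < length t → Nondec 1 t → Nondec 1 b′ → Capped 2 b′ →
    parkScan (t ++ map ((lastOr 0 t ∸ 1) +_) (1 ∷ b′)) ≡ parkScan t ∘w (1 ∷ b′)
  parkScan-∘ (y ∷ r) b′ _ (1≤y , nr) nb cb = begin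
    parkScan (t ++ map (c +_) (1 ∷ b′))                          ≡⟨ scan-++ 1 0 0 t _ ⟩
    parkScan t ++ scan (1 + length t) p u (map (c +_) (1 ∷ b′)) ≡⟨ cong (parkScan t ++_) (scan-block {p = p} {u} c (p ∸ 1) b′ first nb cb room) ⟩
    parkScan t ++ map ((p ∸ 1) +_) (1 ∷ b′)                      ≡⟨ cong (λ M → parkScan t ++ map ((M ∸ 1) +_) (1 ∷ b′)) (sym (maxW-scan 1 0 0 t (s≤s z≤n))) ⟩
    parkScan t ∘w (1 ∷ b′)                                       ∎
    where
    open ≡-Reasoning
    t = y ∷ r
    u = lastOr 0 t
    c = u ∸ 1
    p = lastOut 1 0 0 t
    p<i : p < 1 + length t
    p<i = lastOut-< 1 0 0 t (s≤s z≤n)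
    1≤p : 1 ≤ p
    1≤p = subst (λ h → 1 ≤ lastOut 2 h y r) (sym (m≤n⇒m⊓n≡m 1≤y)) (lastOut-≥ 2 1 y r (s≤s (s≤s z≤n)))
    1≤u : 1 ≤ u
    1≤u = ≤-trans 1≤y (subst (y ≤_) (maxW-lastOr r nr) (m≤m⊔n y (maxW r)))
    first : next (1 + length t) p u (c + 1) ≡ p ∸ 1 + 1
    first = begin
      (1 + length t) ⊓ (p + (c + 1 ∸ u)) ≡⟨ cong (λ g → (1 + length t) ⊓ (p + (g ∸ u))) (m∸n+n≡m 1≤u) ⟩
      (1 + length t) ⊓ (p + (u ∸ u))     ≡⟨ cong (λ g → (1 + length t) ⊓ (p + g)) (n∸n≡0 u) ⟩
      (1 + length t) ⊓ (p + 0)           ≡⟨ cong ((1 + length t) ⊓_) (+-identityʳ p) ⟩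
      (1 + length t) ⊓ p                 ≡⟨ m≥n⇒m⊓n≡n (<⇒≤ p<i) ⟩
      p                                  ≡⟨ sym (m∸n+n≡m 1≤p) ⟩
      p ∸ 1 + 1                          ∎
    room : p ∸ 1 + 2 ≤ suc (1 + length t)
    room = ≤-trans (≤-reflexive (+-comm (p ∸ 1) 2)) (s≤s (s≤s (≤-trans (m∸n≤m p 1) (≤-pred p<i))))

  parkScan-drop-op : ∀ s a k b′ → Nondec 1 a → Capped 1 a → k < length a → Nondec 1 b′ → Capped 2 b′ →
    parkScan (drop k a ++ map (shiftOf s a +_) (1 ∷ b′)) ≡ opW s (parkScan (drop k a)) (1 ∷ b′)
  parkScan-drop-op succ a k b′ na ca k<a nb cb =
    subst (λ n → parkScan (drop k a ++ map (n +_) (1 ∷ b′)) ≡ parkScan (drop k a) • (1 ∷ b′)) len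
          (parkScan-• k (drop k a) b′ (Nondec-drop k a na) (Capped-drop k a ca) nb cb)
    where
    len : k + length (drop k a) ≡ length a
    len = trans (cong (k +_) (length-drop k a)) (m+[n∸m]≡n (<⇒≤ k<a))
  parkScan-drop-op prec a k b′ na ca k<a nb cb =
    subst (λ M → parkScan (drop k a ++ map ((M ∸ 1) +_) (1 ∷ b′)) ≡ parkScan (drop k a) ∘w (1 ∷ b′)) last
          (parkScan-∘ (drop k a) b′ nonempty (Nondec-drop k a na) nb cb)
    where
    nonempty : 0 < length (drop k a)
    nonempty = subst (0 <_) (sym (length-drop k a)) (m<n⇒0<n∸m k<a)
    last : lastOr 0 (drop k a) ≡ maxW a
    last = trans (lastOr-drop k a k<a) (sym (maxW-lastOr a (Nondec-weaken a z≤n na)))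

  last≤length : ∀ a → Capped 1 a → lastOr 0 a ≤ length a
  last≤length a ca = ≤-pred (lastOr-< a ca (s≤s z≤n))

  shiftOf-bounds : ∀ s a → Nondec 1 a → Capped 1 a → shiftOf s a ≤ length a × lastOr 0 a ≤ shiftOf s a + 1
  shiftOf-bounds succ a na ca = ≤-refl , ≤-trans (last≤length a ca) (m≤m+n _ 1)
  shiftOf-bounds prec a na ca =
    ≤-trans (m∸n≤m _ 1) (≤-trans (≤-reflexive max≡last) (last≤length a ca)) ,
    subst (_≤ maxW a ∸ 1 + 1) max≡last (subst (maxW a ≤_) (+-comm 1 (maxW a ∸ 1)) (m≤n+m∸n (maxW a) 1))
    where
    max≡last : maxW a ≡ lastOr 0 a
    max≡last = maxW-lastOr a (Nondec-weaken a z≤n na)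

  shifted-parking : ∀ s a t → Nondec 1 a → Capped 1 a → Nondec 1 t → Capped 1 t →
    Nondec 0 (a ++ map (shiftOf s a +_) t) × Capped 1 (a ++ map (shiftOf s a +_) t)
  shifted-parking s a t na ca nt ct =
    Nondec-++ a _ (Nondec-weaken a z≤n na) (Nondec-weaken _ (proj₂ bounds) (Nondec-shift (shiftOf s a) t nt)) ,
    Capped-++ a _ ca (Capped-shift (shiftOf s a) t ct
                        (subst (_≤ 1 + length a) (+-comm 1 (shiftOf s a)) (s≤s (proj₁ bounds))))
    where
    bounds = shiftOf-bounds s a na ca

module Coproduct {c ℓ} (R : CommutativeRing c ℓ) where
  open ParkingWords
  open Lin R
  open import Data.List using ([]; _∷_; map; length; take; drop)
  open import Data.List.Properties
    using (++-assoc; ++-identityʳ; map-++; map-∘; map-cong-local; length-++; length-map; take-map; drop-map)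
  open import Data.List.Relation.Unary.All as All using (All; []; _∷_)
  open import Data.List.Relation.Unary.All.Properties using (++⁺)
  open import Data.Nat using (ℕ; zero; suc; _+_; _∸_; _≤_; z≤n; s≤s)
  open import Data.Nat.Properties using (+-identityʳ; +-suc; +-comm; m≤n⇒m≤1+n; ≤-refl)
  open import Data.Product using (_×_; _,_; proj₁; proj₂)
  open import Relation.Binary.PropositionalEquality

  range1-+ : ∀ p q → range1 (p + q) ≡ range1 p ++ map (p +_) (range1 q)
  range1-+ p zero    = trans (cong range1 (+-identityʳ p)) (sym (++-identityʳ (range1 p)))
  range1-+ p (suc q) = begin
    range1 (p + suc q)                                          ≡⟨ cong range1 (+-suc p q) ⟩
    range1 (p + q) ++ suc (p + q) ∷ []                          ≡⟨ cong (_++ suc (p + q) ∷ []) (range1-+ p q) ⟩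
    (range1 p ++ map (p +_) (range1 q)) ++ suc (p + q) ∷ []     ≡⟨ ++-assoc (range1 p) _ _ ⟩
    range1 p ++ map (p +_) (range1 q) ++ suc (p + q) ∷ []       ≡⟨ cong (λ z → range1 p ++ map (p +_) (range1 q) ++ z ∷ [])
                                                                        (sym (+-suc p q)) ⟩
    range1 p ++ map (p +_) (range1 q) ++ map (p +_) (suc q ∷ []) ≡⟨ cong (range1 p ++_) (sym (map-++ (p +_) (range1 q) _)) ⟩
    range1 p ++ map (p +_) (range1 (suc q))                     ∎
    where open ≡-Reasoning

  range1-≤ : ∀ q → All (_≤ q) (range1 q)
  range1-≤ zero    = []
  range1-≤ (suc q) = ++⁺ (All.map m≤n⇒m≤1+n (range1-≤ q)) (≤-refl ∷ [])

  cut : Word → ℕ → Word × Word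
  cut w k = park (take k w) , park (drop k w)

  actR : Side → Word → Word × Word → Word × Word
  actR s b ab = proj₁ ab , opW s (proj₂ ab) b

  actL : Side → Word → Word × Word → Word × Word
  actL s a ab = opW s a (proj₁ ab) , proj₂ ab

  module Cuts (s : Side) (a′ b′ : Word) (na′ : Nondec 1 a′) (ca′ : Capped 2 a′)
              (nb′ : Nondec 1 b′) (cb′ : Capped 2 b′) where
    open ≡-Reasoning

    a b : Word
    a = 1 ∷ a′
    b = 1 ∷ b′
    n′ m′ : ℕ
    n′ = length a′
    m′ = length b′
    na : Nondec 1 a
    na = ≤-refl , na′
    ca : Capped 1 a
    ca = ≤-refl , ca′
    nb : Nondec 1 b
    nb = ≤-refl , nb′
    cb : Capped 1 b
    cb = ≤-refl , cb′
    σ : ℕ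
    σ = shiftOf s a
    z w : Word
    z = map (σ +_) b
    w = a ++ z
    len : length w ∸ 1 ≡ n′ + (1 + m′)
    len = cong (_∸ 1) (trans (length-++ a) (cong (length a +_) (length-map (σ +_) b)))

    cut-in-a : ∀ {k} → k ≤ n′ → cut w k ≡ actR s b (cut a k)
    cut-in-a {k} k≤n′ = cong₂ _,_ (cong park (take-++-≤ k a z (m≤n⇒m≤1+n k≤n′))) (begin
      park (drop k w)                     ≡⟨ park-scan (drop k w) (Nondec-drop k w (proj₁ (shifted-parking s a b na ca nb cb))) ⟩
      parkScan (drop k w)                 ≡⟨ cong parkScan (drop-++-≤ k a z (m≤n⇒m≤1+n k≤n′)) ⟩
      parkScan (drop k a ++ z)            ≡⟨ parkScan-drop-op s a k b′ na ca (s≤s k≤n′) nb′ cb′ ⟩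
      opW s (parkScan (drop k a)) b       ≡⟨ cong (λ t → opW s t b) (sym (park-scan (drop k a) (Nondec-drop k a (Nondec-weaken a z≤n na)))) ⟩
      opW s (park (drop k a)) b           ∎)

    inside-a : map (cut w) (range1 n′) ≡ map (actR s b) (δW a)
    inside-a = trans (map-cong-local (All.map cut-in-a (range1-≤ n′))) (map-∘ (range1 n′))

    between : cut w (n′ + 1) ≡ (a , b)
    between = begin
      cut w (n′ + 1)                         ≡⟨ cong (cut w) (trans (+-comm n′ 1) (sym (+-identityʳ (length a)))) ⟩
      park (take (length a + 0) w) , park (drop (length a + 0) w)
                                             ≡⟨ cong₂ (λ l r → park l , park r) (trans (take-++-length 0 a z) (++-identityʳ a))
                                                                                (drop-++-length 0 a z) ⟩
      park a , park z                        ≡⟨ cong₂ _,_ (park-fixes a (Nondec-weaken a z≤n na) ca)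
                                                  (trans (park-scan z (Nondec-weaken z z≤n (Nondec-shift σ b nb)))
                                                  (trans (parkScan-shift σ b nb) (scan-fixes b (Nondec-weaken b z≤n nb) cb))) ⟩
      a , b                                  ∎

    -- a cut inside b: the prefix a · (prefix of b)[σ] is already a parking
    -- function, and the suffix is a shifted suffix of b
    cut-in-b : ∀ {j} → j ≤ m′ → cut w (n′ + (1 + j)) ≡ actL s a (cut b j)
    cut-in-b {j} j≤m′ = trans (cong (cut w) (+-suc n′ j)) (cong₂ _,_ (begin
      park (take (length a + j) w)             ≡⟨ cong park (trans (take-++-length j a z) (cong (a ++_) (take-map j b))) ⟩
      park (a ++ map (σ +_) (take j b))        ≡⟨ park-fixes _ (proj₁ prefix) (proj₂ prefix) ⟩
      a ++ map (σ +_) (take j b)               ≡⟨ sym (opW-shift s a (take j b)) ⟩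
      opW s a (take j b)                       ≡⟨ cong (opW s a) (sym (park-fixes (take j b) (Nondec-weaken _ z≤n ntb) ctb)) ⟩
      opW s a (park (take j b))                ∎) (begin
      park (drop (length a + j) w)             ≡⟨ cong park (trans (drop-++-length j a z) (drop-map j b)) ⟩
      park (map (σ +_) (drop j b))             ≡⟨ park-scan _ (Nondec-weaken _ z≤n (Nondec-shift σ _ ndb)) ⟩
      parkScan (map (σ +_) (drop j b))         ≡⟨ parkScan-shift σ (drop j b) ndb ⟩
      parkScan (drop j b)                      ≡⟨ sym (park-scan (drop j b) (Nondec-weaken _ z≤n ndb)) ⟩
      park (drop j b)                          ∎))
      where
      ntb : Nondec 1 (take j b)
      ntb = Nondec-take j b nb
      ctb : Capped 1 (take j b)
      ctb = Capped-take j b cb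
      ndb : Nondec 1 (drop j b)
      ndb = Nondec-drop j b nb
      prefix : Nondec 0 (a ++ map (σ +_) (take j b)) × Capped 1 (a ++ map (σ +_) (take j b))
      prefix = shifted-parking s a (take j b) na ca ntb ctb

    inside-b : map (cut w) (map (n′ +_) (map (1 +_) (range1 m′))) ≡ map (actL s a) (δW b)
    inside-b = trans (sym (map-∘ (map (1 +_) (range1 m′))))
               (trans (sym (map-∘ (range1 m′)))
               (trans (map-cong-local (All.map cut-in-b (range1-≤ m′))) (map-∘ (range1 m′))))

  δW-op : ∀ s a b → NDPF a → NDPF b →
    δW (opW s a b) ≡ map (actR s b) (δW a) ++ (a , b) ∷ map (actL s a) (δW b)
  δW-op s (1 ∷ a′) (1 ∷ b′) (ndpf a′ na′ ca′) (ndpf b′ nb′ cb′) = begin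
    δW (opW s a b)
      ≡⟨ cong δW (opW-shift s a b) ⟩
    map (cut w) (range1 (length w ∸ 1))
      ≡⟨ cong (λ q → map (cut w) (range1 q)) len ⟩
    map (cut w) (range1 (n′ + (1 + m′)))
      ≡⟨ cong (map (cut w)) (trans (range1-+ n′ (1 + m′)) (cong (λ q → range1 n′ ++ map (n′ +_) q) (range1-+ 1 m′))) ⟩
    map (cut w) (range1 n′ ++ (n′ + 1) ∷ map (n′ +_) (map (1 +_) (range1 m′)))
      ≡⟨ map-++ (cut w) (range1 n′) _ ⟩
    map (cut w) (range1 n′) ++ cut w (n′ + 1) ∷ map (cut w) (map (n′ +_) (map (1 +_) (range1 m′)))
      ≡⟨ cong₂ _++_ inside-a (cong₂ _∷_ between inside-b) ⟩
    map (actR s b) (δW a) ++ (a , b) ∷ map (actL s a) (δW b) ∎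
    where
    open ≡-Reasoning
    open Cuts s a′ b′ na′ ca′ nb′ cb′

module Coefficients {c ℓ} (R : CommutativeRing c ℓ) where
  open Lin R
  open Coproduct R using (actR; actL; δW-op)
  open ParkingWords using (toNDPF)
  open CommutativeRing R renaming (Carrier to K)
  open import Data.List using (List; []; _∷_; map; concatMap)
  open import Data.List.Relation.Unary.All using (All; []; _∷_)
  open import Data.Product using (_×_; _,_; proj₁; proj₂)
  open import Relation.Binary.Definitions using (DecidableEquality)
  open import Relation.Nullary using (yes; no)
  import Relation.Binary.PropositionalEquality as P
  open import Relation.Binary.Reasoning.Setoid setoid

  ∑ : ∀ {a} {A : Set a} → List A → (A → K) → K
  ∑ []      f = 0#
  ∑ (e ∷ l) f = f e + ∑ l f

  module _ {a} {A : Set a} where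
    ∑-cong : ∀ (l : List A) {f g : A → K} → (∀ e → f e ≈ g e) → ∑ l f ≈ ∑ l g
    ∑-cong []      eq = refl
    ∑-cong (e ∷ l) eq = +-cong (eq e) (∑-cong l eq)

    ∑-cong-All : ∀ {q} {P : A → Set q} (l : List A) {f g : A → K} →
      All P l → (∀ {e} → P e → f e ≈ g e) → ∑ l f ≈ ∑ l g
    ∑-cong-All []      []         eq = refl
    ∑-cong-All (e ∷ l) (pe ∷ pl) eq = +-cong (eq pe) (∑-cong-All l pl eq)

    ∑-++ : ∀ (l₁ l₂ : List A) {f : A → K} → ∑ (l₁ ++ l₂) f ≈ ∑ l₁ f + ∑ l₂ f
    ∑-++ []       l₂ = sym (+-identityˡ _)
    ∑-++ (e ∷ l₁) l₂ = trans (+-congˡ (∑-++ l₁ l₂)) (sym (+-assoc _ _ _))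

    ∑-0 : ∀ (l : List A) → ∑ l (λ _ → 0#) ≈ 0#
    ∑-0 []      = refl
    ∑-0 (e ∷ l) = trans (+-identityˡ _) (∑-0 l)

    ∑-+ : ∀ (l : List A) {f g : A → K} → ∑ l (λ e → f e + g e) ≈ ∑ l f + ∑ l g
    ∑-+ []      = sym (+-identityˡ _)
    ∑-+ (e ∷ l) {f} {g} = begin
      (f e + g e) + ∑ l (λ e → f e + g e) ≈⟨ +-congˡ (∑-+ l) ⟩
      (f e + g e) + (∑ l f + ∑ l g)       ≈⟨ +-assoc _ _ _ ⟩
      f e + (g e + (∑ l f + ∑ l g))       ≈⟨ +-congˡ (sym (+-assoc _ _ _)) ⟩
      f e + ((g e + ∑ l f) + ∑ l g)       ≈⟨ +-congˡ (+-congʳ (+-comm _ _)) ⟩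
      f e + ((∑ l f + g e) + ∑ l g)       ≈⟨ +-congˡ (+-assoc _ _ _) ⟩
      f e + (∑ l f + (g e + ∑ l g))       ≈⟨ sym (+-assoc _ _ _) ⟩
      (f e + ∑ l f) + (g e + ∑ l g)       ∎

  module _ {a b} {A : Set a} {B : Set b} where
    ∑-map : ∀ (l : List A) {h : A → B} {f : B → K} → ∑ (map h l) f P.≡ ∑ l (λ e → f (h e))
    ∑-map []      = P.refl
    ∑-map (e ∷ l) = P.cong (_ +_) (∑-map l)

    ∑-concatMap : ∀ (l : List A) {h : A → List B} {f : B → K} → ∑ (concatMap h l) f ≈ ∑ l (λ e → ∑ (h e) f)
    ∑-concatMap []          = refl
    ∑-concatMap (e ∷ l) {h} = trans (∑-++ (h e) (concatMap h l)) (+-congˡ (∑-concatMap l))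

    ∑-swap : ∀ (l₁ : List A) (l₂ : List B) {f : A → B → K} →
      ∑ l₁ (λ e → ∑ l₂ (λ e′ → f e e′)) ≈ ∑ l₂ (λ e′ → ∑ l₁ (λ e → f e e′))
    ∑-swap []       l₂ = sym (∑-0 l₂)
    ∑-swap (e ∷ l₁) l₂ = trans (+-congˡ (∑-swap l₁ l₂)) (sym (∑-+ l₂))

  ∑-nested : ∀ {a b d} {A : Set a} {B : Set b} {C : Set d} (l : List A) (m : A → List B)
    {g : A → B → C} {f : C → K} →
    ∑ (concatMap (λ e → map (g e) (m e)) l) f ≈ ∑ l (λ e → ∑ (m e) (λ e′ → f (g e e′)))
  ∑-nested l m = trans (∑-concatMap l) (∑-cong l (λ e → reflexive (∑-map (m e))))

  module _ {A : Set} (eqA : DecidableEquality A) (p : A) where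
    coeff-single : ∀ e → K
    coeff-single e = coeff eqA (e ∷ []) p

    coeff-∑ : ∀ l → coeff eqA l p ≈ ∑ l coeff-single
    coeff-∑ []            = refl
    coeff-∑ ((r , b) ∷ l) with eqA b p
    ... | yes _ = +-cong (sym (+-identityʳ r)) (coeff-∑ l)
    ... | no  _ = trans (coeff-∑ l) (sym (+-identityˡ _))

  module AtBasisTensor (s : Side) (x y : LC Word) (p : Word × Word) where
    ι : K × (Word × Word) → K
    ι = coeff-single decWW p

    ⟦_⟧ : T → K
    ⟦ t ⟧ = coeff decWW t p

    ⟦⟧-++ : ∀ t u → ⟦ t ++ u ⟧ ≈ ⟦ t ⟧ + ⟦ u ⟧
    ⟦⟧-++ t u = trans (coeff-∑ decWW p (t ++ u)) (trans (∑-++ t u) (sym (+-cong (coeff-∑ decWW p t) (coeff-∑ decWW p u))))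

    ∑∑ : (K × Word → K × Word → K) → K
    ∑∑ F = ∑ x (λ e → ∑ y (λ f → F e f))

    cutsInA between cutsInB : K × Word → K × Word → K
    cutsInA e f = ∑ (δW (proj₂ e)) (λ ab → ι (proj₁ e * proj₁ f , actR s (proj₂ f) ab))
    between e f = ι (proj₁ e * proj₁ f , (proj₂ e , proj₂ f))
    cutsInB e f = ∑ (δW (proj₂ f)) (λ ab → ι (proj₁ e * proj₁ f , actL s (proj₂ e) ab))

    pair : ∀ rq a b → IsNDPF a → IsNDPF b →
      ∑ (δW (opW s a b)) (λ ab → ι (rq , ab))
        ≈ ∑ (δW a) (λ ab → ι (rq , actR s b ab)) + (ι (rq , (a , b)) + ∑ (δW b) (λ ab → ι (rq , actL s a ab)))
    pair rq a b pa pb = begin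
      ∑ (δW (opW s a b)) (λ ab → ι (rq , ab))
        ≡⟨ P.cong (λ L → ∑ L (λ ab → ι (rq , ab))) (δW-op s a b (toNDPF a pa) (toNDPF b pb)) ⟩
      ∑ (map (actR s b) (δW a) ++ (a , b) ∷ map (actL s a) (δW b)) (λ ab → ι (rq , ab))
        ≈⟨ ∑-++ (map (actR s b) (δW a)) _ ⟩
      ∑ (map (actR s b) (δW a)) (λ ab → ι (rq , ab)) + (ι (rq , (a , b)) + ∑ (map (actL s a) (δW b)) (λ ab → ι (rq , ab)))
        ≡⟨ P.cong₂ (λ u v → u + (ι (rq , (a , b)) + v)) (∑-map (δW a)) (∑-map (δW b)) ⟩
      ∑ (δW a) (λ ab → ι (rq , actR s b ab)) + (ι (rq , (a , b)) + ∑ (δW b) (λ ab → ι (rq , actL s a ab))) ∎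

    lhs : InC x → InC y → ⟦ δ (mulC s x y) ⟧ ≈ ∑∑ (λ e f → cutsInA e f + (between e f + cutsInB e f))
    lhs ix iy = begin
      ⟦ δ (mulC s x y) ⟧
        ≈⟨ coeff-∑ decWW p (δ (mulC s x y)) ⟩
      ∑ (δ (mulC s x y)) ι
        ≈⟨ ∑-nested (mulC s x y) (λ e → δW (proj₂ e)) ⟩
      ∑ (mulC s x y) (λ e → ∑ (δW (proj₂ e)) (λ ab → ι (proj₁ e , ab)))
        ≈⟨ ∑-nested x (λ _ → y) ⟩
      ∑∑ (λ e f → ∑ (δW (opW s (proj₂ e) (proj₂ f))) (λ ab → ι (proj₁ e * proj₁ f , ab)))
        ≈⟨ ∑-cong-All x ix (λ {e} pa → ∑-cong-All y iy (λ {f} pb → pair (proj₁ e * proj₁ f) (proj₂ e) (proj₂ f) pa pb)) ⟩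
      ∑∑ (λ e f → cutsInA e f + (between e f + cutsInB e f)) ∎

    tensor-coeff : ⟦ tensor x y ⟧ ≈ ∑∑ between
    tensor-coeff = trans (coeff-∑ decWW p (tensor x y)) (∑-nested x (λ _ → y))

    left-coeff : ⟦ leftTerm s x y ⟧ ≈ ∑∑ cutsInA
    left-coeff = begin
      ⟦ leftTerm s x y ⟧                 ≈⟨ coeff-∑ decWW p (leftTerm s x y) ⟩
      ∑ (leftTerm s x y) ι               ≈⟨ ∑-nested (δ x) (λ _ → y) ⟩
      ∑ (δ x) (λ g → ∑ y (λ f → ι (proj₁ g * proj₁ f , actR s (proj₂ f) (proj₂ g))))
                                          ≈⟨ ∑-nested x (λ e → δW (proj₂ e)) ⟩
      ∑ x (λ e → ∑ (δW (proj₂ e)) (λ ab → ∑ y (λ f → ι (proj₁ e * proj₁ f , actR s (proj₂ f) ab))))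
                                          ≈⟨ ∑-cong x (λ e → ∑-swap (δW (proj₂ e)) y) ⟩
      ∑∑ cutsInA                         ∎

    right-coeff : ⟦ rightTerm s x y ⟧ ≈ ∑∑ cutsInB
    right-coeff = begin
      ⟦ rightTerm s x y ⟧                ≈⟨ coeff-∑ decWW p (rightTerm s x y) ⟩
      ∑ (rightTerm s x y) ι              ≈⟨ ∑-nested (δ y) (λ _ → x) ⟩
      ∑ (δ y) (λ g → ∑ x (λ e → ι (proj₁ e * proj₁ g , actL s (proj₂ e) (proj₂ g))))
                                          ≈⟨ ∑-nested y (λ f → δW (proj₂ f)) ⟩
      ∑ y (λ f → ∑ (δW (proj₂ f)) (λ ab → ∑ x (λ e → ι (proj₁ e * proj₁ f , actL s (proj₂ e) ab))))
                                          ≈⟨ ∑-cong y (λ f → ∑-swap (δW (proj₂ f)) x) ⟩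
      ∑ y (λ f → ∑ x (λ e → cutsInB e f)) ≈⟨ ∑-swap y x ⟩
      ∑∑ cutsInB                         ∎

    ∑∑-+ : ∀ F G → ∑∑ (λ e f → F e f + G e f) ≈ ∑∑ F + ∑∑ G
    ∑∑-+ F G = trans (∑-cong x (λ e → ∑-+ y)) (∑-+ x)

    rhs : ⟦ tensor x y ++ (leftTerm s x y ++ rightTerm s x y) ⟧
            ≈ ∑∑ (λ e f → cutsInA e f + (between e f + cutsInB e f))
    rhs = begin
      ⟦ tensor x y ++ (leftTerm s x y ++ rightTerm s x y) ⟧
        ≈⟨ trans (⟦⟧-++ (tensor x y) _) (+-congˡ (⟦⟧-++ (leftTerm s x y) _)) ⟩
      ⟦ tensor x y ⟧ + (⟦ leftTerm s x y ⟧ + ⟦ rightTerm s x y ⟧)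
        ≈⟨ +-cong tensor-coeff (+-cong left-coeff right-coeff) ⟩
      ∑∑ between + (∑∑ cutsInA + ∑∑ cutsInB)
        ≈⟨ trans (sym (+-assoc _ _ _)) (trans (+-congʳ (+-comm _ _)) (+-assoc _ _ _)) ⟩
      ∑∑ cutsInA + (∑∑ between + ∑∑ cutsInB)
        ≈⟨ sym (trans (∑∑-+ cutsInA _) (+-congˡ (∑∑-+ between cutsInB))) ⟩
      ∑∑ (λ e f → cutsInA e f + (between e f + cutsInB e f)) ∎

mainTheorem2 : ∀ {c ℓ} (R : CommutativeRing c ℓ) → let open Lin R in
    (s : Side) (x y : LC Word) → InC x → InC y →
      δ (mulC s x y) ≈T (tensor x y ++ (leftTerm s x y ++ rightTerm s x y))
mainTheorem2 R s x y ix iy p = trans (lhs ix iy) (sym rhs)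
  where
  open CommutativeRing R using (trans; sym)
  open Coefficients.AtBasisTensor R s x y p
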